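{- Let $H$ be an $r$-uniform hypergraph on vertex set $[n]$ with $m$ edges, and let $s(H)=\sum_{i\in[n]}\left|d_H(i)-\frac{rm}{n}\right|$. Then there exists an $r$-uniform hypergraph $\widehat H$ on the same vertex set $[n]$ with $m$ edges such that $\Delta(\widehat H)-\delta(\widehat H)\le 1$ and $|E(H)\,\triangle\, E(\widehat H)|\le s(H)$ (i.e. $\widehat H$ differs from $H$ in at most $s(H)$ edges).
   Context: An $r$-uniform hypergraph on vertex set $[n]$ has as edges a set of $r$-element subsets of $[n]$ (no multiple edges). $d_H(i)$ is the number of edges of $H$ containing $i$; $\Delta(H)$ and $\delta(H)$ denote the maximum and minimum degree of $H$. -}

module Defs where

open import Data.Nat as ℕ using (ℕ; zero; suc; _⊔_; _⊓_; _≤_; _+_; _*_; NonZero)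
open import Data.Bool using (Bool)
open import Data.Bool.Properties using () renaming (_≟_ to _≟B_)
open import Data.Fin using (Fin)
open import Data.Fin.Subset using (Subset; _∈_; ∣_∣)
open import Data.Fin.Subset.Properties using (_∈?_)
open import Data.Vec.Properties using (≡-dec)
open import Data.List using (List; length; filter; map; foldr; allFin)
open import Data.List.Relation.Unary.All using (All)
open import Data.List.Relation.Unary.Unique.Propositional using (Unique)
open import Relation.Binary.PropositionalEquality using (_≡_)
open import Relation.Binary.Definitions using (DecidableEquality)
open import Relation.Nullary.Decidable using (¬?)
open import Data.Integer as ℤ using (ℤ)
open import Data.Rational as ℚ using (ℚ; 0ℚ)

_≟S_ : ∀ {n} → DecidableEquality (Subset n)
_≟S_ = ≡-dec _≟B_


record Hypergraph (n r : ℕ) : Set where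
  constructor hypergraph
  field
    edges   : List (Subset n)
    unique  : Unique edges
    uniform : All (λ e → ∣ e ∣ ≡ r) edges
open Hypergraph public

numEdges : ∀ {n r} → Hypergraph n r → ℕ
numEdges H = length (edges H)

deg : ∀ {n r} → Hypergraph n r → Fin n → ℕ
deg H i = length (filter (i ∈?_) (edges H))

-- Δ(H): maximum degree (0 on an empty vertex set)
maxDeg : ∀ {n r} → Hypergraph n r → ℕ
maxDeg {n} H = foldr _⊔_ 0 (map (deg H) (allFin n))

minDeg : ∀ {n r} → Hypergraph n r → ℕ
minDeg {zero}  H = 0
minDeg {suc n} H = foldr _⊓_ (deg H Fin.zero) (map (deg H) (allFin (suc n)))

symDiff : ∀ {n r} → Hypergraph n r → Hypergraph n r → ℕ
symDiff {n} H H' = length (filter (λ e → ¬? (e ∈L? edges H')) (edges H))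
                 + length (filter (λ e → ¬? (e ∈L? edges H)) (edges H'))
  where open import Data.List.Membership.DecPropositional (_≟S_ {n}) renaming (_∈?_ to _∈L?_)

s : ∀ {n r} .{{_ : NonZero n}} → Hypergraph n r → ℚ
s {n} {r} H = foldr ℚ._+_ 0ℚ
  (map (λ i → ℚ.∣ (ℤ.+ deg H i ℚ./ 1) ℚ.- (ℤ.+ (r * numEdges H) ℚ./ n) ∣) (allFin n))

module Submission where

open import Defs
open import Data.Nat using (ℕ; NonZero; _≤_; _∸_; suc)
open import Data.Integer using (+_)
open import Data.Rational using (_/_) renaming (_≤_ to _≤ℚ_)
open import Data.Product using (Σ; _×_)
open import Relation.Binary.PropositionalEquality using (_≡_)

open import Data.Nat.Properties
open import Algebra.Properties.CommutativeMonoid.Sum +-0-commutativeMonoid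
  using (sum; sum-syntax; sum-cong-≗; ∑-distrib-+; sum-replicate-zero)
open import Algebra.Properties.CommutativeSemigroup +-commutativeSemigroup using (xy∙z≈zy∙x; interchange)
open import Algebra.Properties.Semiring.Sum +-*-semiring using (*-distribˡ-sum)
open import Data.Bool using (true; false; if_then_else_) renaming (_≟_ to _≟B_)
open import Data.Bool.Properties using (¬-not)
open import Data.Fin using (Fin; zero; suc) renaming (_≟_ to _≟F_)
open import Data.Fin.Subset using (Subset; inside; outside; ∣_∣) renaming (_∈_ to _∈ₛ_; _∉_ to _∉ₛ_)
open import Data.Fin.Subset.Properties using (_∈?_)
import Data.Integer as ℤ
import Data.Integer.Properties as ℤ
open import Data.List using (List; []; _∷_; length; filter; foldr; map; allFin; tabulate)
open import Data.List.Membership.Propositional using (_∈_; _∉_; find; lose)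
open import Data.List.Membership.Propositional.Properties
  using (foldr-selective; ∈-map⁺; ∈-map⁻; ∈-allFin; ∈-filter⁺; ∈-filter⁻)
import Data.List.Membership.DecPropositional as DecMembership
open import Data.List.Membership.Setoid.Properties using (∈-∷=⁺-untouched)
open import Data.List.Properties using (foldr-preservesᵒ; filter-notAll; filter-none; length-∷=; filter-≐; map-tabulate)
import Data.List.Relation.Unary.All as All
open import Data.List.Relation.Unary.All using (All; []; _∷_)
open import Data.List.Relation.Unary.All.Properties using (¬Any⇒All¬)
open import Data.List.Relation.Unary.AllPairs using ([]; _∷_)
import Data.List.Relation.Unary.Any as Any
open import Data.List.Relation.Unary.Any using (Any; any?; here; there; _∷=_; index)
open import Data.List.Relation.Unary.Unique.Propositional using (Unique)
import Data.List.Relation.Unary.Unique.Propositional.Properties as Unique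
open import Data.Nat using (zero; _+_; _*_; _<_; _⊔_; _⊓_; z≤n; s≤s; _≤?_; _<?_)
open import Data.Nat.DivMod using (_%_; m≡m%n+[m/n]*n; m%n<n; m/n*n≤m) renaming (_/_ to _div_)
open import Data.Nat.Solver using (module +-*-Solver)
open import Data.Product using (_,_; ∃-syntax; swap)
import Data.Rational as ℚ
import Data.Rational.Properties as ℚ
open import Data.Rational.Unnormalised using (ℚᵘ; mkℚᵘ; *≡*; *≤*)
import Data.Rational.Unnormalised as ℚᵘ
import Data.Rational.Unnormalised.Properties as ℚᵘ
open import Data.Sum using (_⊎_; inj₁; inj₂; [_,_])
import Data.Vec as Vec
open import Data.Vec using ([]; _∷_; lookup; _[_]≔_)
open import Data.Vec.Functional using (Vector)
open import Data.Vec.Properties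
  using (lookup∘update; lookup∘update′; []=⇒lookup; lookup⇒[]=; tabulate∘lookup; tabulate-cong)
open import Function using (_∘_; _$_)
open import Relation.Binary.Definitions using (DecidableEquality)
open import Relation.Binary.PropositionalEquality
  using (setoid; _≢_; refl; sym; trans; cong; cong₂; subst; subst₂; module ≡-Reasoning)
open import Relation.Nullary using (Dec; yes; no; does; ¬_; ¬?; _×-dec_; contradiction)
open import Relation.Nullary.Decidable using (dec-true; dec-false)
open import Relation.Unary using (Decidable)
open import Relation.Unary.Properties using (_∩?_; ∁?)

-- Let S = r m and q = ⌊S / n⌋, and measure the distance of a degree sequence d from balance by
-- imbalance d = max (Σ (dᵢ − q − 1)⁺) (Σ (q − dᵢ)⁺).  As long as Δ − δ ≥ 2, take u of maximum and
-- v of minimum degree.  Some edge e ∋ u with v ∉ e has e − u + v ∉ E(H), for otherwise e ↦ e − u + v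
-- would inject the edges through u but not v into those through v but not u, forcing d u ≤ d v.
-- Replacing e by e − u + v moves one unit of degree from u to v, changes two edges, and strictly
-- lowers the imbalance.  Since n q ≤ S < n (q + 1), both n Σ (dᵢ − q − 1)⁺ and n Σ (q − dᵢ)⁺ are at
-- most Σ (n dᵢ − S)⁺ = Σ (S − n dᵢ)⁺ = n s(H) / 2, so the total change 2 · imbalance is at most s(H).

sum-mono-≤ : ∀ {n} {f g : Vector ℕ n} → (∀ i → f i ≤ g i) → sum f ≤ sum g
sum-mono-≤ {zero}  f≤g = z≤n
sum-mono-≤ {suc n} f≤g = +-mono-≤ (f≤g zero) (sum-mono-≤ (f≤g ∘ suc))

sum-mono-< : ∀ {n} {f g : Vector ℕ n} (j : Fin n) → (∀ i → f i ≤ g i) → f j < g j → sum f < sum g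
sum-mono-< zero    f≤g fj<gj = +-mono-<-≤ fj<gj (sum-mono-≤ (f≤g ∘ suc))
sum-mono-< (suc j) f≤g fj<gj = +-mono-≤-< (f≤g zero) (sum-mono-< j (f≤g ∘ suc) fj<gj)

sum-const : ∀ n c → ∑[ i < n ] c ≡ n * c
sum-const zero    c = refl
sum-const (suc n) c = cong (_+_ c) (sum-const n c)

sum-∸≡sum-∸ : ∀ {n} (x : Vector ℕ n) c → sum x ≡ n * c →
              ∑[ i < n ] (x i ∸ c) ≡ ∑[ i < n ] (c ∸ x i)
sum-∸≡sum-∸ {n} x c Σx≡nc = +-cancelʳ-≡ (n * c) _ _ (begin
  ∑[ i < n ] (x i ∸ c) + n * c        ≡⟨ cong (_+_ (∑[ i < n ] (x i ∸ c))) (sum-const n c) ⟨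
  ∑[ i < n ] (x i ∸ c) + ∑[ i < n ] c  ≡⟨ ∑-distrib-+ (λ i → x i ∸ c) (λ _ → c) ⟨
  ∑[ i < n ] (x i ∸ c + c)            ≡⟨ sum-cong-≗ (λ i → ∸-+-swap (x i)) ⟩
  ∑[ i < n ] (c ∸ x i + x i)          ≡⟨ ∑-distrib-+ (λ i → c ∸ x i) x ⟩
  ∑[ i < n ] (c ∸ x i) + sum x        ≡⟨ cong (_+_ (∑[ i < n ] (c ∸ x i))) Σx≡nc ⟩
  ∑[ i < n ] (c ∸ x i) + n * c        ∎)
  where
  open ≡-Reasoning
  ∸-+-swap : ∀ x → x ∸ c + c ≡ c ∸ x + x
  ∸-+-swap x with x ≤? c
  ... | yes x≤c = trans (cong (_+ c) (m≤n⇒m∸n≡0 x≤c)) (sym (m∸n+n≡m x≤c))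
  ... | no  x≰c = let c≤x = <⇒≤ (≰⇒> x≰c) in
                  trans (m∸n+n≡m c≤x) (sym (cong (_+ x) (m≤n⇒m∸n≡0 c≤x)))

≤-sum : ∀ {n} (f : Vector ℕ n) j → f j ≤ sum f
≤-sum f zero    = m≤m+n (f zero) _
≤-sum f (suc j) = ≤-trans (≤-sum (f ∘ suc) j) (m≤n+m _ (f zero))

sum-zero : ∀ {n} {f : Vector ℕ n} → (∀ i → f i ≡ 0) → sum f ≡ 0
sum-zero {n} f≡0 = trans (sum-cong-≗ f≡0) (sum-replicate-zero n)

-- Imbalance of a degree sequence

record MovesUnit {n} (u v : Fin n) (d d' : Vector ℕ n) : Set where
  field
    source : suc (d' u) ≡ d u
    target : d' v ≡ suc (d v)
    others : ∀ i → i ≢ u → i ≢ v → d' i ≡ d i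

  ≤-off-target : ∀ i → i ≢ v → d' i ≤ d i
  ≤-off-target i i≢v with i ≟F u
  ... | yes refl = ≤-trans (n≤1+n (d' u)) (≤-reflexive source)
  ... | no  i≢u  = ≤-reflexive (others i i≢u i≢v)

  ≥-off-source : ∀ i → i ≢ u → d i ≤ d' i
  ≥-off-source i i≢u with i ≟F v
  ... | yes refl = ≤-trans (n≤1+n (d v)) (≤-reflexive (sym target))
  ... | no  i≢v  = ≤-reflexive (sym (others i i≢u i≢v))

-- ∣ n x − S ∣, so that s(H) = Σᵢ deviation n S (d i) / n.
deviation : ℕ → ℕ → ℕ → ℕ
deviation n S x = (n * x ∸ S) + (S ∸ n * x)

module Balancing {n} (S q : ℕ) (n*q≤S : n * q ≤ S) (S<n*[1+q] : S < n * suc q) where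

  excess deficit imbalance : Vector ℕ n → ℕ
  excess    d = ∑[ i < n ] (d i ∸ suc q)
  deficit   d = ∑[ i < n ] (q ∸ d i)
  imbalance d = excess d ⊔ deficit d

  module _ {d : Vector ℕ n} (Σd≡S : sum d ≡ S) where

    min≤q : ∀ {v} → (∀ i → d v ≤ d i) → d v ≤ q
    min≤q {v} min = ≤-pred (*-cancelˡ-< n (d v) (suc q) (begin-strict
      n * d v         ≡⟨ sum-const n (d v) ⟨
      ∑[ i < n ] d v  ≤⟨ sum-mono-≤ min ⟩
      sum d           ≡⟨ Σd≡S ⟩
      S               <⟨ S<n*[1+q] ⟩
      n * suc q       ∎))
      where open ≤-Reasoning

    q<max : ∀ {u v} → (∀ i → d i ≤ d u) → d v < d u → q < d u
    q<max {u} {v} max dv<du with q <? d u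
    ... | yes q<du = q<du
    ... | no  q≮du = contradiction n*q≤S (<⇒≱ (begin-strict
      S              ≡⟨ Σd≡S ⟨
      sum d          <⟨ sum-mono-< v (λ i → ≤-trans (max i) du≤q) (<-≤-trans dv<du du≤q) ⟩
      ∑[ i < n ] q   ≡⟨ sum-const n q ⟩
      n * q          ∎))
      where
      open ≤-Reasoning
      du≤q = ≮⇒≥ q≮du

    imbalance-bound : n * (2 * imbalance d) ≤ ∑[ i < n ] deviation n S (d i)
    imbalance-bound = begin
      n * (2 * imbalance d)                   ≡⟨ cong (λ x → n * (imbalance d + x)) (+-identityʳ _) ⟩
      n * (imbalance d + imbalance d)         ≡⟨ *-distribˡ-+ n (imbalance d) _ ⟩
      n * imbalance d + n * imbalance d       ≤⟨ +-mono-≤ n*imbalance≤above (≤-trans n*imbalance≤above (≤-reflexive above≡below)) ⟩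
      above + below                           ≡⟨ ∑-distrib-+ (λ i → n * d i ∸ S) (λ i → S ∸ n * d i) ⟨
      ∑[ i < n ] deviation n S (d i)          ∎
      where
      open ≤-Reasoning
      above = ∑[ i < n ] (n * d i ∸ S)
      below = ∑[ i < n ] (S ∸ n * d i)
      above≡below : above ≡ below
      above≡below = sum-∸≡sum-∸ (λ i → n * d i) S (trans (sym (*-distribˡ-sum n d)) (cong (n *_) Σd≡S))
      n*excess≤above : n * excess d ≤ above
      n*excess≤above = begin
        n * excess d                       ≡⟨ *-distribˡ-sum n (λ i → d i ∸ suc q) ⟩
        ∑[ i < n ] (n * (d i ∸ suc q))     ≡⟨ sum-cong-≗ (λ i → *-distribˡ-∸ n (d i) (suc q)) ⟩
        ∑[ i < n ] (n * d i ∸ n * suc q)   ≤⟨ sum-mono-≤ (λ i → ∸-monoʳ-≤ (n * d i) (<⇒≤ S<n*[1+q])) ⟩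
        above                              ∎
      n*deficit≤below : n * deficit d ≤ below
      n*deficit≤below = begin
        n * deficit d                      ≡⟨ *-distribˡ-sum n (λ i → q ∸ d i) ⟩
        ∑[ i < n ] (n * (q ∸ d i))         ≡⟨ sum-cong-≗ (λ i → *-distribˡ-∸ n q (d i)) ⟩
        ∑[ i < n ] (n * q ∸ n * d i)       ≤⟨ sum-mono-≤ (λ i → ∸-monoˡ-≤ (n * d i) n*q≤S) ⟩
        below                              ∎
      n*imbalance≤above : n * imbalance d ≤ above
      n*imbalance≤above = ≤-trans (≤-reflexive (*-distribˡ-⊔ n (excess d) (deficit d)))
        (⊔-lub n*excess≤above (≤-trans n*deficit≤below (≤-reflexive (sym above≡below))))

  module _ {u v} {d d' : Vector ℕ n} (moves : MovesUnit u v d d')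
           (max : ∀ i → d i ≤ d u) (min : ∀ i → d v ≤ d i) where
    open MovesUnit moves

    excess-decreases : 2 + q ≤ d u → d v ≤ q → excess d' < excess d
    excess-decreases 2+q≤du dv≤q = sum-mono-< u pointwise (∸-monoˡ-< d'u<du 1+q≤d'u)
      where
      d'u<du = ≤-reflexive source
      1+q≤d'u = ≤-pred (≤-trans 2+q≤du (≤-reflexive (sym source)))
      d'v≤1+q = ≤-trans (≤-reflexive target) (s≤s dv≤q)
      pointwise : ∀ i → d' i ∸ suc q ≤ d i ∸ suc q
      pointwise i with i ≟F v
      ... | yes refl = ≤-trans (≤-reflexive (m≤n⇒m∸n≡0 d'v≤1+q)) z≤n
      ... | no  i≢v  = ∸-monoˡ-≤ (suc q) (≤-off-target i i≢v)

    deficit-decreases : d v < q → q < d u → deficit d' < deficit d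
    deficit-decreases dv<q q<du = sum-mono-< v pointwise (∸-monoʳ-< d'v>dv d'v≤q)
      where
      d'v>dv = ≤-reflexive (sym target)
      d'v≤q = ≤-trans (≤-reflexive target) dv<q
      q≤d'u = ≤-pred (≤-trans q<du (≤-reflexive (sym source)))
      pointwise : ∀ i → q ∸ d' i ≤ q ∸ d i
      pointwise i with i ≟F u
      ... | yes refl = ≤-trans (≤-reflexive (m≤n⇒m∸n≡0 q≤d'u)) z≤n
      ... | no  i≢u  = ∸-monoʳ-≤ q (≥-off-source i i≢u)

    excess-vanishes : d u ≤ suc q → d v ≤ q → excess d' ≡ 0
    excess-vanishes du≤1+q dv≤q = sum-zero (λ i → m≤n⇒m∸n≡0 (d'≤1+q i))
      where
      d'≤1+q : ∀ i → d' i ≤ suc q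
      d'≤1+q i with i ≟F v
      ... | yes refl = ≤-trans (≤-reflexive target) (s≤s dv≤q)
      ... | no  i≢v  = ≤-trans (≤-off-target i i≢v) (≤-trans (max i) du≤1+q)

    deficit-vanishes : q ≤ d v → q < d u → deficit d' ≡ 0
    deficit-vanishes q≤dv q<du = sum-zero (λ i → m≤n⇒m∸n≡0 (q≤d' i))
      where
      q≤d' : ∀ i → q ≤ d' i
      q≤d' i with i ≟F u
      ... | yes refl = ≤-pred (≤-trans q<du (≤-reflexive (sym source)))
      ... | no  i≢u  = ≤-trans q≤dv (≤-trans (min i) (≥-off-source i i≢u))

    imbalance-decreases : 2 + d v ≤ d u → d v ≤ q → q < d u → imbalance d' < imbalance d
    imbalance-decreases gap dv≤q q<du = ⊔-lub excess<imbalance deficit<imbalance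
      where
      excess<imbalance : excess d' < imbalance d
      excess<imbalance with 2 + q ≤? d u
      ... | yes 2+q≤du = <-≤-trans (excess-decreases 2+q≤du dv≤q) (m≤m⊔n _ _)
      ... | no  2+q≰du = subst (_< imbalance d) (sym (excess-vanishes du≤1+q dv≤q))
          (<-≤-trans (<-≤-trans (m<n⇒0<n∸m dv<q) (≤-sum (λ i → q ∸ d i) v)) (m≤n⊔m _ _))
        where
        du≤1+q = ≤-pred (≰⇒> 2+q≰du)
        dv<q = ≤-pred (≤-trans gap du≤1+q)
      deficit<imbalance : deficit d' < imbalance d
      deficit<imbalance with d v <? q
      ... | yes dv<q = <-≤-trans (deficit-decreases dv<q q<du) (m≤n⊔m _ _)
      ... | no  dv≮q = subst (_< imbalance d) (sym (deficit-vanishes q≤dv q<du))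
          (<-≤-trans (<-≤-trans (m<n⇒0<n∸m 1+q<du) (≤-sum (λ i → d i ∸ suc q) u)) (m≤m⊔n _ _))
        where
        q≤dv = ≮⇒≥ dv≮q
        1+q<du = ≤-trans (s≤s (s≤s q≤dv)) gap

foldr-⊔-upper : ∀ {x} b {xs : List ℕ} → x ∈ xs → x ≤ foldr _⊔_ b xs
foldr-⊔-upper b x∈xs = foldr-preservesᵒ (λ m n → [ m≤n⇒m≤n⊔o n , m≤n⇒m≤o⊔n m ]) b _
  (inj₂ (Any.map ≤-reflexive x∈xs))

foldr-⊓-lower : ∀ {x} b {xs : List ℕ} → x ∈ xs → foldr _⊓_ b xs ≤ x
foldr-⊓-lower b x∈xs = foldr-preservesᵒ (λ m n → [ m≤n⇒m⊓o≤n n , m≤n⇒o⊓m≤n m ]) b _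
  (inj₂ (Any.map (≤-reflexive ∘ sym) x∈xs))

module _ {n} (d : Vector ℕ (suc n)) where

  private
    values = map d (allFin (suc n))
    max = foldr _⊔_ 0 values
    min = foldr _⊓_ (d zero) values

  ≤-max : ∀ i → d i ≤ max
  ≤-max i = foldr-⊔-upper 0 (∈-map⁺ d (∈-allFin i))

  min-≤ : ∀ i → min ≤ d i
  min-≤ i = foldr-⊓-lower (d zero) (∈-map⁺ d (∈-allFin i))

  min-attained : ∃[ v ] min ≡ d v
  min-attained with foldr-selective ⊓-sel (d zero) values
  ... | inj₁ min≡d0 = zero , min≡d0
  ... | inj₂ min∈   = let (v , _ , min≡dv) = ∈-map⁻ d min∈ in v , min≡dv

  max-attained : max ≡ 0 ⊎ ∃[ u ] max ≡ d u
  max-attained with foldr-selective ⊔-sel 0 values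
  ... | inj₁ max≡0 = inj₁ max≡0
  ... | inj₂ max∈  = let (u , _ , max≡du) = ∈-map⁻ d max∈ in inj₂ (u , max≡du)

  range≤1⊎extremes-apart : max ∸ min ≤ 1 ⊎
    ∃[ u ] ∃[ v ] (∀ i → d i ≤ d u) × (∀ i → d v ≤ d i) × 2 + d v ≤ d u
  range≤1⊎extremes-apart with max ∸ min ≤? 1 | max-attained | min-attained
  ... | yes range≤1 | _ | _ = inj₁ range≤1
  ... | no  _ | inj₁ max≡0 | _ = inj₁ (subst (λ m → m ∸ min ≤ 1) (sym max≡0) (≤-trans (≤-reflexive (0∸n≡0 min)) z≤n))
  ... | no  range≰1 | inj₂ (u , max≡du) | (v , min≡dv) =
    inj₂ (u , v , (λ i → subst (d i ≤_) max≡du (≤-max i)) , (λ i → subst (_≤ d i) min≡dv (min-≤ i)) , gap)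
    where
    gap : 2 + d v ≤ d u
    gap = subst₂ (λ m M → 2 + m ≤ M) min≡dv max≡du
            (m≤o∸n⇒m+n≤o 2 (≤-trans (min-≤ u) (≤-max u)) (≰⇒> range≰1))

indicator : {P : Set} → Dec P → ℕ
indicator P? = if does P? then 1 else 0

indicator≤1 : {P : Set} (P? : Dec P) → indicator P? ≤ 1
indicator≤1 (yes _) = s≤s z≤n
indicator≤1 (no  _) = z≤n

indicator-yes : {P : Set} (P? : Dec P) → P → indicator P? ≡ 1
indicator-yes P? p = cong (if_then 1 else 0) (dec-true P? p)

indicator-no : {P : Set} (P? : Dec P) → ¬ P → indicator P? ≡ 0
indicator-no P? ¬p = cong (if_then 1 else 0) (dec-false P? ¬p)

indicator-cong : {P Q : Set} (P? : Dec P) (Q? : Dec Q) → (P → Q) → (Q → P) → indicator P? ≡ indicator Q?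
indicator-cong (yes _) (yes _) _   _   = refl
indicator-cong (no  _) (no  _) _   _   = refl
indicator-cong (yes p) (no ¬q) p→q _   = contradiction (p→q p) ¬q
indicator-cong (no ¬p) (yes q) _   q→p = contradiction (q→p q) ¬p

module _ {A : Set} {P : A → Set} (P? : Decidable P) where

  length-filter-∷ : ∀ x xs → length (filter P? (x ∷ xs)) ≡ indicator (P? x) + length (filter P? xs)
  length-filter-∷ x xs with does (P? x)
  ... | true  = refl
  ... | false = refl

  length-filter-∷= : ∀ {x y} {xs : List A} (x∈xs : x ∈ xs) →
    length (filter P? (x∈xs ∷= y)) + indicator (P? x) ≡ length (filter P? xs) + indicator (P? y)
  length-filter-∷= {x} {y} {_ ∷ xs} (here refl) = begin
    length (filter P? (y ∷ xs)) + indicator (P? x)           ≡⟨ cong (_+ indicator (P? x)) (length-filter-∷ y xs) ⟩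
    indicator (P? y) + length (filter P? xs) + indicator (P? x) ≡⟨ xy∙z≈zy∙x (indicator (P? y)) _ _ ⟩
    indicator (P? x) + length (filter P? xs) + indicator (P? y) ≡⟨ cong (_+ indicator (P? y)) (length-filter-∷ x xs) ⟨
    length (filter P? (x ∷ xs)) + indicator (P? y)           ∎
    where open ≡-Reasoning
  length-filter-∷= {x} {y} {z ∷ xs} (there x∈xs) = begin
    length (filter P? (z ∷ (x∈xs ∷= y))) + indicator (P? x)            ≡⟨ cong (_+ indicator (P? x)) (length-filter-∷ z _) ⟩
    indicator (P? z) + length (filter P? (x∈xs ∷= y)) + indicator (P? x) ≡⟨ +-assoc (indicator (P? z)) _ _ ⟩
    indicator (P? z) + (length (filter P? (x∈xs ∷= y)) + indicator (P? x)) ≡⟨ cong (_+_ (indicator (P? z))) (length-filter-∷= x∈xs) ⟩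
    indicator (P? z) + (length (filter P? xs) + indicator (P? y))       ≡⟨ +-assoc (indicator (P? z)) _ _ ⟨
    indicator (P? z) + length (filter P? xs) + indicator (P? y)         ≡⟨ cong (_+ indicator (P? y)) (length-filter-∷ z xs) ⟨
    length (filter P? (z ∷ xs)) + indicator (P? y)                    ∎
    where open ≡-Reasoning

module _ {A : Set} where

  All-∷= : ∀ {P : A → Set} {x y} {xs : List A} (x∈xs : x ∈ xs) → All P xs → P y → All P (x∈xs ∷= y)
  All-∷= (here refl)  (_  ∷ pxs) py = py ∷ pxs
  All-∷= (there x∈xs) (pz ∷ pxs) py = pz ∷ All-∷= x∈xs pxs py

  Unique-∷= : ∀ {x y} {xs : List A} (x∈xs : x ∈ xs) → Unique xs → y ∉ xs → Unique (x∈xs ∷= y)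
  Unique-∷= {xs = _ ∷ xs} (here refl) (_ ∷ uniq) y∉ = ¬Any⇒All¬ xs (y∉ ∘ there) ∷ uniq
  Unique-∷= (there x∈xs) (z≢xs ∷ uniq) y∉ =
    All-∷= x∈xs z≢xs (λ z≡y → y∉ (here (sym z≡y))) ∷ Unique-∷= x∈xs uniq (y∉ ∘ there)

  module _ {B : Set} (_≟_ : DecidableEquality B) where

    length-≤-injective : (f : A → B) {xs : List A} {ys : List B} → Unique xs →
      (∀ {x y} → x ∈ xs → y ∈ xs → f x ≡ f y → x ≡ y) → (∀ {x} → x ∈ xs → f x ∈ ys) →
      length xs ≤ length ys
    length-≤-injective f {[]} _ _ _ = z≤n
    length-≤-injective f {x ∷ xs} {ys} (x≢xs ∷ uniq) inj into = begin
      suc (length xs)   ≤⟨ s≤s (length-≤-injective f uniq (λ y∈ z∈ → inj (there y∈) (there z∈)) into-rest) ⟩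
      suc (length rest) ≤⟨ filter-notAll (λ y → ¬? (y ≟ f x)) ys (Any.map (λ fx≡y y≢fx → y≢fx (sym fx≡y)) (into (here refl))) ⟩
      length ys         ∎
      where
      open ≤-Reasoning
      rest = filter (λ y → ¬? (y ≟ f x)) ys
      into-rest : ∀ {y} → y ∈ xs → f y ∈ rest
      into-rest y∈xs = ∈-filter⁺ (λ y → ¬? (y ≟ f x)) (into (there y∈xs))
        (λ fy≡fx → All.lookup x≢xs y∈xs (inj (here refl) (there y∈xs) (sym fy≡fx)))

indicator-split : {P Q : Set} (P? : Dec P) (Q? : Dec Q) →
  indicator P? ≡ indicator (P? ×-dec Q?) + indicator (P? ×-dec ¬? Q?)
indicator-split (yes _) (yes _) = refl
indicator-split (yes _) (no  _) = refl
indicator-split (no  _) _       = refl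

module _ {A : Set} {P Q : A → Set} (P? : Decidable P) (Q? : Decidable Q) where

  length-filter-split : ∀ xs → length (filter P? xs) ≡ length (filter (P? ∩? Q?) xs) + length (filter (P? ∩? ∁? Q?) xs)
  length-filter-split []       = refl
  length-filter-split (x ∷ xs) = begin
    length (filter P? (x ∷ xs))                                   ≡⟨ length-filter-∷ P? x xs ⟩
    indicator (P? x) + length (filter P? xs)                      ≡⟨ cong₂ _+_ (indicator-split (P? x) (Q? x)) (length-filter-split xs) ⟩
    (indicator ((P? ∩? Q?) x) + indicator ((P? ∩? ∁? Q?) x)) + (length (filter (P? ∩? Q?) xs) + length (filter (P? ∩? ∁? Q?) xs))
                                                                  ≡⟨ interchange (indicator ((P? ∩? Q?) x)) _ _ _ ⟩
    (indicator ((P? ∩? Q?) x) + length (filter (P? ∩? Q?) xs)) + (indicator ((P? ∩? ∁? Q?) x) + length (filter (P? ∩? ∁? Q?) xs))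
                                                                  ≡⟨ cong₂ _+_ (length-filter-∷ (P? ∩? Q?) x xs) (length-filter-∷ (P? ∩? ∁? Q?) x xs) ⟨
    length (filter (P? ∩? Q?) (x ∷ xs)) + length (filter (P? ∩? ∁? Q?) (x ∷ xs)) ∎
    where open ≡-Reasoning

-- Moving a point of a subset

∣∷∣ : ∀ {n} b (p : Subset n) → ∣ b ∷ p ∣ ≡ indicator (b ≟B inside) + ∣ p ∣
∣∷∣ inside  p = refl
∣∷∣ outside p = refl

∣[]≔∣ : ∀ {n} (p : Subset n) i b → ∣ p [ i ]≔ b ∣ + indicator (lookup p i ≟B inside) ≡ ∣ p ∣ + indicator (b ≟B inside)
∣[]≔∣ (x ∷ p) zero b = begin
  ∣ b ∷ p ∣ + indicator (x ≟B inside)                          ≡⟨ cong (_+ indicator (x ≟B inside)) (∣∷∣ b p) ⟩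
  indicator (b ≟B inside) + ∣ p ∣ + indicator (x ≟B inside)    ≡⟨ xy∙z≈zy∙x (indicator (b ≟B inside)) _ _ ⟩
  indicator (x ≟B inside) + ∣ p ∣ + indicator (b ≟B inside)    ≡⟨ cong (_+ indicator (b ≟B inside)) (∣∷∣ x p) ⟨
  ∣ x ∷ p ∣ + indicator (b ≟B inside)                          ∎
  where open ≡-Reasoning
∣[]≔∣ (x ∷ p) (suc i) b = begin
  ∣ x ∷ (p [ i ]≔ b) ∣ + indicator (lookup p i ≟B inside)                   ≡⟨ cong (_+ _) (∣∷∣ x (p [ i ]≔ b)) ⟩
  indicator (x ≟B inside) + ∣ p [ i ]≔ b ∣ + indicator (lookup p i ≟B inside) ≡⟨ +-assoc (indicator (x ≟B inside)) _ _ ⟩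
  indicator (x ≟B inside) + (∣ p [ i ]≔ b ∣ + indicator (lookup p i ≟B inside)) ≡⟨ cong (_+_ (indicator (x ≟B inside))) (∣[]≔∣ p i b) ⟩
  indicator (x ≟B inside) + (∣ p ∣ + indicator (b ≟B inside))               ≡⟨ +-assoc (indicator (x ≟B inside)) _ _ ⟨
  indicator (x ≟B inside) + ∣ p ∣ + indicator (b ≟B inside)                 ≡⟨ cong (_+ _) (∣∷∣ x p) ⟨
  ∣ x ∷ p ∣ + indicator (b ≟B inside)                                      ∎
  where open ≡-Reasoning

∈ₛ-resp-lookup : ∀ {n} {p p' : Subset n} {i} → lookup p i ≡ lookup p' i → i ∈ₛ p → i ∈ₛ p'
∈ₛ-resp-lookup {p' = p'} {i} eq i∈p = lookup⇒[]= i p' (trans (sym eq) ([]=⇒lookup i∈p))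

move : ∀ {n} → Fin n → Fin n → Subset n → Subset n
move u v e = e [ u ]≔ outside [ v ]≔ inside

module _ {n} {u v : Fin n} (u≢v : u ≢ v) where

  lookup-move-source : ∀ e → lookup (move u v e) u ≡ outside
  lookup-move-source e = trans (lookup∘update′ u≢v (e [ u ]≔ outside) inside) (lookup∘update u e outside)

  lookup-move-target : ∀ e → lookup (move u v e) v ≡ inside
  lookup-move-target e = lookup∘update v (e [ u ]≔ outside) inside

  lookup-move-other : ∀ e {i} → i ≢ u → i ≢ v → lookup (move u v e) i ≡ lookup e i
  lookup-move-other e i≢u i≢v = trans (lookup∘update′ i≢v (e [ u ]≔ outside) inside) (lookup∘update′ i≢u e outside)

  ∣move∣ : ∀ {e} → u ∈ₛ e → v ∉ₛ e → ∣ move u v e ∣ ≡ ∣ e ∣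
  ∣move∣ {e} u∈e v∉e = begin
    ∣ move u v e ∣                                                  ≡⟨ +-identityʳ _ ⟨
    ∣ move u v e ∣ + 0                                              ≡⟨ cong (λ b → ∣ move u v e ∣ + indicator (b ≟B inside)) v-outside ⟨
    ∣ move u v e ∣ + indicator (lookup (e [ u ]≔ outside) v ≟B inside) ≡⟨ ∣[]≔∣ (e [ u ]≔ outside) v inside ⟩
    ∣ e [ u ]≔ outside ∣ + 1                                        ≡⟨ cong (λ b → ∣ e [ u ]≔ outside ∣ + indicator (b ≟B inside)) ([]=⇒lookup u∈e) ⟨
    ∣ e [ u ]≔ outside ∣ + indicator (lookup e u ≟B inside)           ≡⟨ ∣[]≔∣ e u outside ⟩
    ∣ e ∣ + 0                                                       ≡⟨ +-identityʳ _ ⟩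
    ∣ e ∣                                                           ∎
    where
    open ≡-Reasoning
    v-outside : lookup (e [ u ]≔ outside) v ≡ outside
    v-outside = trans (lookup∘update′ (u≢v ∘ sym) e outside) (¬-not (v∉e ∘ lookup⇒[]= v e))

  source∉move : ∀ e → u ∉ₛ move u v e
  source∉move e u∈ = contradiction (trans (sym ([]=⇒lookup u∈)) (lookup-move-source e)) λ ()

  target∈move : ∀ e → v ∈ₛ move u v e
  target∈move e = lookup⇒[]= v _ (lookup-move-target e)

  move-injective : ∀ {e₁ e₂} → u ∈ₛ e₁ → v ∉ₛ e₁ → u ∈ₛ e₂ → v ∉ₛ e₂ → move u v e₁ ≡ move u v e₂ → e₁ ≡ e₂
  move-injective {e₁} {e₂} u∈e₁ v∉e₁ u∈e₂ v∉e₂ moves≡ = begin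
    e₁                       ≡⟨ tabulate∘lookup e₁ ⟨
    Vec.tabulate (lookup e₁) ≡⟨ tabulate-cong pointwise ⟩
    Vec.tabulate (lookup e₂) ≡⟨ tabulate∘lookup e₂ ⟩
    e₂                       ∎
    where
    open ≡-Reasoning
    pointwise : ∀ i → lookup e₁ i ≡ lookup e₂ i
    pointwise i with i ≟F u | i ≟F v
    ... | yes refl | _        = trans ([]=⇒lookup u∈e₁) (sym ([]=⇒lookup u∈e₂))
    ... | no _     | yes refl = trans (¬-not (v∉e₁ ∘ lookup⇒[]= v e₁)) (sym (¬-not (v∉e₂ ∘ lookup⇒[]= v e₂)))
    ... | no i≢u   | no i≢v   = begin
      lookup e₁ i             ≡⟨ lookup-move-other e₁ i≢u i≢v ⟨
      lookup (move u v e₁) i  ≡⟨ cong (λ e → lookup e i) moves≡ ⟩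
      lookup (move u v e₂) i  ≡⟨ lookup-move-other e₂ i≢u i≢v ⟩
      lookup e₂ i             ∎

∑-indicator≡∣∣ : ∀ {n} (e : Subset n) → ∑[ i < n ] indicator (i ∈? e) ≡ ∣ e ∣
∑-indicator≡∣∣ []            = refl
∑-indicator≡∣∣ (inside  ∷ e) = cong suc (∑-indicator≡∣∣ e)
∑-indicator≡∣∣ (outside ∷ e) = ∑-indicator≡∣∣ e

module _ {n r : ℕ} where

  handshake : ∀ E → All (λ e → ∣ e ∣ ≡ r) E → ∑[ i < n ] length (filter (i ∈?_) E) ≡ r * length E
  handshake []      []             = trans (sum-replicate-zero n) (sym (*-zeroʳ r))
  handshake (e ∷ E) (∣e∣≡r ∷ rest) = begin
    ∑[ i < n ] length (filter (i ∈?_) (e ∷ E))                          ≡⟨ sum-cong-≗ (λ i → length-filter-∷ (i ∈?_) e E) ⟩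
    ∑[ i < n ] (indicator (i ∈? e) + length (filter (i ∈?_) E))         ≡⟨ ∑-distrib-+ (λ i → indicator (i ∈? e)) _ ⟩
    ∑[ i < n ] indicator (i ∈? e) + ∑[ i < n ] length (filter (i ∈?_) E) ≡⟨ cong₂ _+_ (trans (∑-indicator≡∣∣ e) ∣e∣≡r) (handshake E rest) ⟩
    r + r * length E                                                   ≡⟨ *-suc r (length E) ⟨
    r * length (e ∷ E)                                                 ∎
    where open ≡-Reasoning

  ∑-deg≡r*numEdges : (H : Hypergraph n r) → ∑[ i < n ] deg H i ≡ r * numEdges H
  ∑-deg≡r*numEdges H = handshake (edges H) (uniform H)

  module _ (X : Hypergraph n r) {u v : Fin n} (u≢v : u ≢ v) where
    private
      open DecMembership (_≟S_ {n}) using () renaming (_∈?_ to _∈L?_)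
      E = edges X
      u∈? : Decidable (u ∈ₛ_)
      u∈? = u ∈?_
      v∈? : Decidable (v ∈ₛ_)
      v∈? = v ∈?_

    Movable : Subset n → Set
    Movable e = u ∈ₛ e × v ∉ₛ e × move u v e ∉ E

    movable? : Decidable Movable
    movable? e = u ∈? e ×-dec ¬? (v ∈? e) ×-dec ¬? (move u v e ∈L? E)

    deg≤-unless-movable : ¬ Any Movable E → deg X u ≤ deg X v
    deg≤-unless-movable none = begin
      deg X u                                                            ≡⟨ length-filter-split u∈? v∈? E ⟩
      length (filter (u∈? ∩? v∈?) E) + length (filter (u∈? ∩? ∁? v∈?) E) ≤⟨ +-mono-≤
        (≤-reflexive (cong length (filter-≐ (u∈? ∩? v∈?) (v∈? ∩? u∈?) (swap , swap) E)))
        (length-≤-injective _≟S_ (move u v) (Unique.filter⁺ _ (unique X)) injective-on into) ⟩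
      length (filter (v∈? ∩? u∈?) E) + length (filter (v∈? ∩? ∁? u∈?) E) ≡⟨ length-filter-split v∈? u∈? E ⟨
      deg X v                                                            ∎
      where
      open ≤-Reasoning
      moved∈E : ∀ {e} → e ∈ E → u ∈ₛ e → v ∉ₛ e → move u v e ∈ E
      moved∈E {e} e∈E u∈e v∉e with move u v e ∈L? E
      ... | yes moved∈E = moved∈E
      ... | no  moved∉E = contradiction (lose e∈E (u∈e , v∉e , moved∉E)) none
      into : ∀ {e} → e ∈ filter (u∈? ∩? ∁? v∈?) E → move u v e ∈ filter (v∈? ∩? ∁? u∈?) E
      into e∈ with ∈-filter⁻ (u∈? ∩? ∁? v∈?) {xs = E} e∈
      ... | e∈E , u∈e , v∉e = ∈-filter⁺ (v∈? ∩? ∁? u∈?) (moved∈E e∈E u∈e v∉e) (target∈move u≢v _ , source∉move u≢v _)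
      injective-on : ∀ {e₁ e₂} → e₁ ∈ filter (u∈? ∩? ∁? v∈?) E → e₂ ∈ filter (u∈? ∩? ∁? v∈?) E →
                     move u v e₁ ≡ move u v e₂ → e₁ ≡ e₂
      injective-on e₁∈ e₂∈ with ∈-filter⁻ (u∈? ∩? ∁? v∈?) {xs = E} e₁∈ | ∈-filter⁻ (u∈? ∩? ∁? v∈?) {xs = E} e₂∈
      ... | _ , u∈e₁ , v∉e₁ | _ , u∈e₂ , v∉e₂ = move-injective u≢v u∈e₁ v∉e₁ u∈e₂ v∉e₂

    movable-edge : deg X v < deg X u → ∃[ e ] e ∈ E × Movable e
    movable-edge dv<du with any? movable? E
    ... | yes some = find some
    ... | no  none = contradiction dv<du (≤⇒≯ (deg≤-unless-movable none))

  module Swap (X : Hypergraph n r) {u v : Fin n} (u≢v : u ≢ v) {e : Subset n} (e∈X : e ∈ edges X)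
              (u∈e : u ∈ₛ e) (v∉e : v ∉ₛ e) (moved∉X : move u v e ∉ edges X) where

    swapped : Hypergraph n r
    swapped = hypergraph (e∈X ∷= move u v e) (Unique-∷= e∈X (unique X) moved∉X)
      (All-∷= e∈X (uniform X) (trans (∣move∣ u≢v u∈e v∉e) (All.lookup (uniform X) e∈X)))

    numEdges-swapped : numEdges swapped ≡ numEdges X
    numEdges-swapped = length-∷= (edges X) (index e∈X) (move u v e)

    deg-swapped : MovesUnit u v (deg X) (deg swapped)
    deg-swapped = record { source = source ; target = target ; others = others }
      where
      open ≡-Reasoning
      counts : ∀ i → deg swapped i + indicator (i ∈? e) ≡ deg X i + indicator (i ∈? move u v e)
      counts i = length-filter-∷= (i ∈?_) e∈X
      source : suc (deg swapped u) ≡ deg X u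
      source = begin
        suc (deg swapped u)                       ≡⟨ +-comm 1 _ ⟩
        deg swapped u + 1                         ≡⟨ cong (_+_ (deg swapped u)) (indicator-yes (u ∈? e) u∈e) ⟨
        deg swapped u + indicator (u ∈? e)         ≡⟨ counts u ⟩
        deg X u + indicator (u ∈? move u v e)      ≡⟨ cong (_+_ (deg X u)) (indicator-no (u ∈? move u v e) (source∉move u≢v e)) ⟩
        deg X u + 0                               ≡⟨ +-identityʳ _ ⟩
        deg X u                                   ∎
      target : deg swapped v ≡ suc (deg X v)
      target = begin
        deg swapped v                             ≡⟨ +-identityʳ _ ⟨
        deg swapped v + 0                         ≡⟨ cong (_+_ (deg swapped v)) (indicator-no (v ∈? e) v∉e) ⟨
        deg swapped v + indicator (v ∈? e)         ≡⟨ counts v ⟩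
        deg X v + indicator (v ∈? move u v e)      ≡⟨ cong (_+_ (deg X v)) (indicator-yes (v ∈? move u v e) (target∈move u≢v e)) ⟩
        deg X v + 1                               ≡⟨ +-comm _ 1 ⟩
        suc (deg X v)                             ∎
      others : ∀ i → i ≢ u → i ≢ v → deg swapped i ≡ deg X i
      others i i≢u i≢v = +-cancelʳ-≡ (indicator (i ∈? e)) _ _ (begin
        deg swapped i + indicator (i ∈? e)         ≡⟨ counts i ⟩
        deg X i + indicator (i ∈? move u v e)      ≡⟨ cong (_+_ (deg X i)) (indicator-cong (i ∈? move u v e) (i ∈? e)
                                                       (∈ₛ-resp-lookup unchanged) (∈ₛ-resp-lookup (sym unchanged))) ⟩
        deg X i + indicator (i ∈? e)               ∎)
        where unchanged = lookup-move-other u≢v e i≢u i≢v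

    symDiff-swapped : ∀ G → symDiff G swapped ≤ symDiff G X + 2
    symDiff-swapped G = begin
      symDiff G swapped                     ≤⟨ +-mono-≤ missing-from-swapped extra-in-swapped ⟩
      (missing-from X + 1) + (extra-in X + 1) ≡⟨ interchange (missing-from X) 1 (extra-in X) 1 ⟩
      symDiff G X + 2                       ∎
      where
      open ≤-Reasoning
      open DecMembership (_≟S_ {n}) using () renaming (_∈?_ to _∈L?_)
      missing-from extra-in : Hypergraph n r → ℕ
      missing-from Y = length (filter (λ x → ¬? (x ∈L? edges Y)) (edges G))
      extra-in     Y = length (filter (λ x → ¬? (x ∈L? edges G)) (edges Y))
      missing-from-swapped : missing-from swapped ≤ missing-from X + 1
      missing-from-swapped = ≤-trans
        (length-≤-injective _≟S_ (λ x → x) (Unique.filter⁺ _ (unique G)) (λ _ _ x≡y → x≡y) into)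
        (≤-reflexive (+-comm 1 _))
        where
        into : ∀ {x} → x ∈ filter (λ x → ¬? (x ∈L? edges swapped)) (edges G) →
               x ∈ e ∷ filter (λ x → ¬? (x ∈L? edges X)) (edges G)
        into {x} x∈ with ∈-filter⁻ (λ y → ¬? (y ∈L? edges swapped)) {xs = edges G} x∈ | e ≟S x
        ... | _ , _ | yes refl = here refl
        ... | x∈G , x∉swapped | no e≢x = there (∈-filter⁺ (λ y → ¬? (y ∈L? edges X)) x∈G
              (λ x∈X → x∉swapped (∈-∷=⁺-untouched (setoid _) e∈X e≢x x∈X)))
      extra-in-swapped : extra-in swapped ≤ extra-in X + 1
      extra-in-swapped = begin
        extra-in swapped                                     ≤⟨ m≤m+n _ _ ⟩
        extra-in swapped + indicator (¬? (e ∈L? edges G))      ≡⟨ length-filter-∷= (λ x → ¬? (x ∈L? edges G)) e∈X ⟩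
        extra-in X + indicator (¬? (move u v e ∈L? edges G))   ≤⟨ +-monoʳ-≤ (extra-in X) (indicator≤1 (¬? (move u v e ∈L? edges G))) ⟩
        extra-in X + 1                                       ∎

-- The rational sum s(H)

∣+m-+n∣ : ∀ m n → ℤ.∣ + m ℤ.- + n ∣ ≡ (m ∸ n) + (n ∸ m)
∣+m-+n∣ m n with m ≤? n
... | yes m≤n rewrite ℤ.m-n≡m⊖n m n | ℤ.∣⊖∣-≤ m≤n | m≤n⇒m∸n≡0 m≤n = refl
... | no  m≰n rewrite ℤ.m-n≡m⊖n m n | ℤ.⊖-≥ (<⇒≤ (≰⇒> m≰n)) | m≤n⇒m∸n≡0 (<⇒≤ (≰⇒> m≰n)) = sym (+-identityʳ _)

module _ (k : ℕ) where
  private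
    n = suc k
    _/n : ℕ → ℚᵘ
    a /n = (+ a) ℚᵘ./ n

  /n-+ : ∀ a b → (a /n) ℚᵘ.+ (b /n) ℚᵘ.≃ ((a + b) /n)
  /n-+ a b = *≡* (begin
    (+ a ℤ.* + n ℤ.+ + b ℤ.* + n) ℤ.* + n ≡⟨ cong₂ (λ x y → (x ℤ.+ y) ℤ.* + n) (ℤ.pos-* a n) (ℤ.pos-* b n) ⟨
    + (a * n + b * n) ℤ.* + n             ≡⟨ ℤ.pos-* (a * n + b * n) n ⟨
    + ((a * n + b * n) * n)               ≡⟨ cong +_ (solve 3 (λ x y z → (x :* z :+ y :* z) :* z := (x :+ y) :* (z :* z)) refl a b n) ⟩
    + ((a + b) * (n * n))                 ≡⟨ ℤ.pos-* (a + b) (n * n) ⟩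
    + (a + b) ℤ.* + (n * n)               ∎)
    where
    open ≡-Reasoning
    open +-*-Solver

  toℚᵘ-∣x-S/n∣ : ∀ x S → ℚ.toℚᵘ ℚ.∣ (+ x) / 1 ℚ.- (+ S) / n ∣ ℚᵘ.≃ (deviation n S x /n)
  toℚᵘ-∣x-S/n∣ x S = ℚᵘ.≃-trans (ℚ.toℚᵘ-homo-∣-∣ ((+ x) / 1 ℚ.- (+ S) / n)) (ℚᵘ.≃-trans (ℚᵘ.∣-∣-cong difference) (*≡* numerator))
    where
    difference : ℚ.toℚᵘ ((+ x) / 1 ℚ.- (+ S) / n) ℚᵘ.≃ (mkℚᵘ (+ x) 0 ℚᵘ.- mkℚᵘ (+ S) k)
    difference = ℚᵘ.≃-trans (ℚ.toℚᵘ-homo-+ ((+ x) / 1) (ℚ.- ((+ S) / n)))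
      (ℚᵘ.+-cong (ℚ.toℚᵘ-fromℚᵘ (mkℚᵘ (+ x) 0))
                 (ℚᵘ.≃-trans (ℚ.toℚᵘ-homo‿- ((+ S) / n)) (ℚᵘ.-‿cong (ℚ.toℚᵘ-fromℚᵘ (mkℚᵘ (+ S) k)))))
    numerator : + ℤ.∣ + x ℤ.* + n ℤ.+ ℤ.- + S ℤ.* + 1 ∣ ℤ.* + n ≡ + deviation n S x ℤ.* + (1 * n)
    numerator = cong₂ (λ a b → + a ℤ.* + b)
      (trans (cong ℤ.∣_∣ (cong₂ ℤ._+_ (sym (ℤ.pos-* x n)) (ℤ.*-identityʳ (ℤ.- + S))))
             (trans (∣+m-+n∣ (x * n) S) (cong (λ y → (y ∸ S) + (S ∸ y)) (*-comm x n))))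
      (sym (*-identityˡ n))

  toℚᵘ-sum : ∀ {m} (g : Fin m → ℚ.ℚ) (a : Fin m → ℕ) → (∀ i → ℚ.toℚᵘ (g i) ℚᵘ.≃ (a i /n)) →
             ℚ.toℚᵘ (foldr ℚ._+_ ℚ.0ℚ (tabulate g)) ℚᵘ.≃ (sum a /n)
  toℚᵘ-sum {zero}  g a _   = *≡* refl
  toℚᵘ-sum {suc m} g a g≃a = ℚᵘ.≃-trans (ℚ.toℚᵘ-homo-+ (g zero) _)
    (ℚᵘ.≃-trans (ℚᵘ.+-cong (g≃a zero) (toℚᵘ-sum (g ∘ suc) (a ∘ suc) (g≃a ∘ suc))) (/n-+ (a zero) _))

  ≤-∑∣x-S/n∣ : ∀ (d : Fin n → ℕ) S m → n * m ≤ ∑[ i < n ] deviation n S (d i) →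
    (+ m) / 1 ℚ.≤ foldr ℚ._+_ ℚ.0ℚ (map (λ i → ℚ.∣ (+ d i) / 1 ℚ.- (+ S) / n ∣) (allFin n))
  ≤-∑∣x-S/n∣ d S m n*m≤Σ =
    subst (λ xs → (+ m) / 1 ℚ.≤ foldr ℚ._+_ ℚ.0ℚ xs) (sym (map-tabulate (λ i → i) ∣d-S/n∣)) $
    ℚ.toℚᵘ-cancel-≤ $
    ℚᵘ.≤-respˡ-≃ (ℚᵘ.≃-sym (ℚ.toℚᵘ-fromℚᵘ (mkℚᵘ (+ m) 0))) $
    ℚᵘ.≤-respʳ-≃ (ℚᵘ.≃-sym (toℚᵘ-sum ∣d-S/n∣ (deviation n S ∘ d) (λ i → toℚᵘ-∣x-S/n∣ (d i) S))) $
    *≤* (subst₂ ℤ._≤_ (ℤ.pos-* m n) (ℤ.pos-* total 1) (ℤ.+≤+ (begin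
      m * n      ≡⟨ *-comm m n ⟩
      n * m      ≤⟨ n*m≤Σ ⟩
      total      ≡⟨ *-identityʳ total ⟨
      total * 1  ∎)))
    where
    open ≤-Reasoning
    total = ∑[ i < n ] deviation n S (d i)
    ∣d-S/n∣ : Fin n → ℚ.ℚ
    ∣d-S/n∣ i = ℚ.∣ (+ d i) / 1 ℚ.- (+ S) / n ∣

-- Balancing a hypergraph

module _ {A : Set} (Inv Done : A → Set) (μ cost : A → ℕ) (c : ℕ)
         (step : ∀ {x} → Inv x → Done x ⊎ ∃[ y ] Inv y × μ y < μ x × cost y ≤ cost x + c) where

  descent-within : ∀ k {x} → μ x ≤ k → Inv x → ∃[ y ] Inv y × Done y × cost y ≤ cost x + c * μ x
  descent-within k {x} μx≤k inv-x with step inv-x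
  ... | inj₁ done = x , inv-x , done , m≤m+n (cost x) _
  descent-within zero    μx≤0 _ | inj₂ (_ , _ , μy<μx , _) = contradiction (≤-trans μy<μx μx≤0) λ ()
  descent-within (suc k) {x} μx≤k _ | inj₂ (y , inv-y , μy<μx , cost-y)
    with descent-within k (≤-pred (≤-trans μy<μx μx≤k)) inv-y
  ... | z , inv-z , done , cost-z = z , inv-z , done , (begin
    cost z                        ≤⟨ cost-z ⟩
    cost y + c * μ y              ≤⟨ +-monoˡ-≤ (c * μ y) cost-y ⟩
    cost x + c + c * μ y          ≡⟨ +-assoc (cost x) c (c * μ y) ⟩
    cost x + (c + c * μ y)        ≡⟨ cong (_+_ (cost x)) (*-suc c (μ y)) ⟨
    cost x + c * suc (μ y)        ≤⟨ +-monoʳ-≤ (cost x) (*-monoʳ-≤ c μy<μx) ⟩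
    cost x + c * μ x              ∎)
    where open ≤-Reasoning

  descent : ∀ {x} → Inv x → ∃[ y ] Inv y × Done y × cost y ≤ cost x + c * μ x
  descent = descent-within _ ≤-refl

m<n*[1+m/n] : ∀ m n .{{_ : NonZero n}} → m < n * suc (m div n)
m<n*[1+m/n] m n = begin-strict
  m                          ≡⟨ m≡m%n+[m/n]*n m n ⟩
  m % n + (m div n) * n      <⟨ +-monoˡ-< _ (m%n<n m n) ⟩
  n + (m div n) * n          ≡⟨ *-comm (suc (m div n)) n ⟩
  n * suc (m div n)          ∎
  where open ≤-Reasoning

AlmostRegular : ∀ {n r} → Hypergraph n r → Set
AlmostRegular H = maxDeg H ∸ minDeg H ≤ 1

symDiff-self : ∀ {n r} (H : Hypergraph n r) → symDiff H H ≡ 0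
symDiff-self {n} H = cong₂ _+_ no-missing no-missing
  where
  open DecMembership (_≟S_ {n}) using () renaming (_∈?_ to _∈L?_)
  no-missing : length (filter (λ x → ¬? (x ∈L? edges H)) (edges H)) ≡ 0
  no-missing = cong length (filter-none (λ x → ¬? (x ∈L? edges H)) (All.tabulate λ x∈ x∉ → x∉ x∈))

module HypergraphBalancing {n r : ℕ} (H : Hypergraph (suc n) r) where

  S q : ℕ
  S = r * numEdges H
  q = S div suc n

  open Balancing {suc n} S q (≤-trans (≤-reflexive (*-comm (suc n) q)) (m/n*n≤m S (suc n))) (m<n*[1+m/n] S (suc n)) public

  ∑deg≡S : ∀ {X : Hypergraph (suc n) r} → numEdges X ≡ numEdges H → sum (deg X) ≡ S
  ∑deg≡S {X} m≡ = trans (∑-deg≡r*numEdges X) (cong (r *_) m≡)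

  balancing-step : ∀ {X : Hypergraph (suc n) r} → numEdges X ≡ numEdges H → AlmostRegular X ⊎
    ∃[ Y ] numEdges Y ≡ numEdges H × imbalance (deg Y) < imbalance (deg X) × symDiff H Y ≤ symDiff H X + 2
  balancing-step {X} m≡ with range≤1⊎extremes-apart (deg X)
  ... | inj₁ almost-regular = inj₁ almost-regular
  ... | inj₂ (u , v , max , min , gap) = inj₂ (swap-movable (movable-edge X u≢v dv<du))
    where
    dv<du = ≤-trans (n≤1+n _) gap
    u≢v : u ≢ v
    u≢v u≡v = <-irrefl (cong (deg X) (sym u≡v)) dv<du
    swap-movable : ∃[ e ] e ∈ edges X × Movable X u≢v e →
      ∃[ Y ] numEdges Y ≡ numEdges H × imbalance (deg Y) < imbalance (deg X) × symDiff H Y ≤ symDiff H X + 2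
    swap-movable (e , e∈X , u∈e , v∉e , moved∉X) = swapped , trans numEdges-swapped m≡ ,
      imbalance-decreases deg-swapped max min gap (min≤q (∑deg≡S {X} m≡) min) (q<max (∑deg≡S {X} m≡) max dv<du) ,
      symDiff-swapped H
      where open Swap X u≢v e∈X u∈e v∉e moved∉X

  rebalanced : ∃[ H' ] numEdges H' ≡ numEdges H × AlmostRegular H' × symDiff H H' ≤ 2 * imbalance (deg H)
  rebalanced with descent (λ X → numEdges X ≡ numEdges H) AlmostRegular (λ X → imbalance (deg X)) (symDiff H) 2
                          (λ {X} → balancing-step {X}) {H} refl
  ... | H' , m≡ , almost-regular , symDiff≤ =
    H' , m≡ , almost-regular , subst (λ x → symDiff H H' ≤ x + 2 * imbalance (deg H)) (symDiff-self H) symDiff≤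

lemma3p3 : (n r : ℕ) .{{_ : NonZero n}} (H : Hypergraph n r) →
    Σ (Hypergraph n r) λ H' →
      (numEdges H' ≡ numEdges H) ×
      (maxDeg H' ∸ minDeg H' ≤ 1) ×
      ((+ symDiff H H') / 1 ≤ℚ s H)
lemma3p3 (suc n) r H =
  let (H' , m≡ , almost-regular , symDiff≤) = rebalanced in
  H' , m≡ , almost-regular ,
  ≤-∑∣x-S/n∣ n (deg H) S (symDiff H H')
    (≤-trans (*-monoʳ-≤ (suc n) symDiff≤) (imbalance-bound {deg H} (∑deg≡S {H} refl)))
  where open HypergraphBalancing H
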